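{- For all words $\mathfrak u, \mathfrak v \in \mathfrak C$, we have $(\mathfrak {u}\sqcup\!\sqcup \mathfrak{v})\star q = (\mathfrak{u}\star q)\sqcup\!\sqcup (\mathfrak{v} \star q)$. Equivalently, if $\mathfrak{u} \sqcup\!\sqcup \mathfrak{v} = \sum \mathfrak{a}_i$, then $(\mathfrak{u}\star q) \sqcup\!\sqcup (\mathfrak{v}\star q) = \sum (\mathfrak{a}_i\star q)$.
   Context: Let $\mathbb F_q$ be the finite field with $q$ elements, of characteristic $p$. Let $\Sigma=\{x_n\}_{n\geq 1}$ be an alphabet; let $\langle\Sigma\rangle$ be the set of words over $\Sigma$ (the empty word is denoted $1$), and let $\mathfrak C=\mathbb F_q\langle\Sigma\rangle$ be the $\mathbb F_q$-vector space with basis $\langle\Sigma\rangle$. A nonempty word is written $\mathfrak a=x_a\mathfrak a_-$. For $a,b,i\in\mathbb N$ put $\Delta^i_{a,b}=(-1)^{a-1}\binom{i-1}{a-1}+(-1)^{b-1}\binom{i-1}{b-1}\in\mathbb F_p$ if $(q-1)\mid i$ and $0<i<a+b$, and $\Delta^i_{a,b}=0$ otherwise. Define $\mathbb F_q$-bilinear products $\diamond$ (diamond) and $\sqcup\!\sqcup$ (shuffle) on $\mathfrak C$ recursively by $1\diamond\mathfrak a=\mathfrak a\diamond 1=\mathfrak a$, $1\sqcup\!\sqcup\mathfrak a=\mathfrak a\sqcup\!\sqcup 1=\mathfrak a$, and for nonempty words $\mathfrak a,\mathfrak b$: $\mathfrak a\diamond\mathfrak b=x_{a+b}(\mathfrak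 a_-\sqcup\!\sqcup\mathfrak b_-)+\sum_{i+j=a+b}\Delta^j_{a,b}\,x_i(x_j\sqcup\!\sqcup(\mathfrak a_-\sqcup\!\sqcup\mathfrak b_-))$, $\mathfrak a\sqcup\!\sqcup\mathfrak b=x_a(\mathfrak a_-\sqcup\!\sqcup\mathfrak b)+x_b(\mathfrak a\sqcup\!\sqcup\mathfrak b_-)+\mathfrak a\diamond\mathfrak b$. The operator $\star q$ is defined by $x_{s_1}x_{s_2}\cdots x_{s_r}\star q=x_{qs_1}x_{qs_2}\cdots x_{qs_r}$, $1\star q=1$, extended $\mathbb F_p$-linearly. -}

module Defs where

open import Data.Nat as ℕ using (ℕ; zero; suc; _∸_; _<?_; _≤_)
open import Data.Nat.Divisibility using (_∣?_)
open import Data.Nat.Combinatorics using (_C_)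
open import Data.Integer as ℤ using (ℤ; +_; -_)
open import Data.Integer.Divisibility using () renaming (_∣_ to _∣ℤ_)
open import Data.List using (List; []; _∷_; _++_; map; concatMap; length; upTo)
open import Data.List.Properties using (≡-dec)
open import Data.Product using (_×_; _,_)
open import Data.Bool using (if_then_else_; _∧_)
open import Relation.Nullary.Decidable using (does)

-- A word x_{s_1} ... x_{s_r} is the list of indices [s_1, ..., s_r];
-- the empty word 1 is [].
Word : Set
Word = List ℕ

-- An element of the free vector space on words, as a finite formal sum
-- of (coefficient, word) pairs; coefficients are integers, read modulo p
-- (they all lie in the prime field F_p).
Poly : Set
Poly = List (ℤ × Word)

coeff : Word → Poly → ℤ
coeff w [] = + 0
coeff w ((c , u) ∷ P) with does (≡-dec ℕ._≟_ w u)
... | Data.Bool.true  = c ℤ.+ coeff w P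
... | Data.Bool.false = coeff w P

-- equality in F_p<Σ> (hence in F_q<Σ>): all coefficients agree mod p
_≈[_]_ : Poly → ℕ → Poly → Set
P ≈[ p ] Q = ∀ (w : Word) → (+ p) ∣ℤ (coeff w P ℤ.- coeff w Q)

scale : ℤ → Poly → Poly
scale c = map (λ { (d , w) → (c ℤ.* d , w) })

prefix : ℕ → Poly → Poly
prefix i = map (λ { (d , w) → (d , i ∷ w) })

sign : ℕ → ℤ
sign k = if does (2 ∣? k) then + 1 else - (+ 1)

Δ : ℕ → ℕ → ℕ → ℕ → ℤ
Δ q a b i =
  if does ((q ∸ 1) ∣? i) ∧ does (0 <? i) ∧ does (i <? a ℕ.+ b)
  then sign (a ∸ 1) ℤ.* (+ ((i ∸ 1) C (a ∸ 1)))
       ℤ.+ sign (b ∸ 1) ℤ.* (+ ((i ∸ 1) C (b ∸ 1)))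
  else + 0

-- The first ℕ argument is fuel; all recursive calls are on
-- pairs of words of strictly smaller total length, so the fuel
-- (length 𝔞 + length 𝔟) used below is always sufficient.
mutual
  sh : ℕ → ℕ → Word → Word → Poly
  sh q f [] v = (+ 1 , v) ∷ []
  sh q f (a ∷ u) [] = (+ 1 , a ∷ u) ∷ []
  sh q zero (a ∷ u) (b ∷ v) = []   -- unreachable with sufficient fuel
  sh q (suc f) (a ∷ u) (b ∷ v) =
    prefix a (sh q f u (b ∷ v)) ++ prefix b (sh q f (a ∷ u) v) ++ dm q f a u b v

  dm : ℕ → ℕ → ℕ → Word → ℕ → Word → Poly
  dm q f a u b v =
    prefix (a ℕ.+ b) (sh q f u v) ++
    concatMap (λ j → scale (Δ q a b j) (prefix (a ℕ.+ b ∸ j) (shP q f ((+ 1 , j ∷ []) ∷ []) (sh q f u v))))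
              (upTo (a ℕ.+ b ℕ.+ 1))

  shP : ℕ → ℕ → Poly → Poly → Poly
  shP q f P Q = concatMap (λ { (c , u) → concatMap (λ { (d , v) → scale (c ℤ.* d) (sh q f u v) }) Q }) P

shuffle : ℕ → Word → Word → Poly
shuffle q u v = sh q (length u ℕ.+ length v) u v

diamond : ℕ → ℕ → Word → ℕ → Word → Poly
diamond q a u b v = dm q (length u ℕ.+ length v) a u b v

starW : ℕ → Word → Word
starW q = map (q ℕ.*_)

starP : ℕ → Poly → Poly
starP q = map (λ { (c , w) → (c , starW q w) })

module Submission where

-- Since ⋆ q sends x_a 𝔲 to x_{qa} (𝔲 ⋆ q) and
-- is additive, everything reduces to the coefficients of the diamond product.  For q = pⁿ, Lucas'
-- theorem gives C(qj - 1, qa - 1) ≡ C(j - 1, a - 1) and C(i - 1, qa - 1) ≡ 0 (mod p) unless q ∣ i,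
-- and (-1)^{qa-1} ≡ (-1)^{a-1} (mod p) because q is odd or p = 2.  Hence Δ^{qj}_{qa,qb} ≡ Δ^j_{a,b}
-- and Δ^i_{qa,qb} ≡ 0 for q ∤ i, so in (𝔞 ⋆ q) ⋄ (𝔟 ⋆ q) only the summands with i = qj survive, and
-- they are the images of the summands of 𝔞 ⋄ 𝔟.  Letters must be positive: Δ^i_{0,qb} ≢ 0 for some
-- q ∤ i.

open import Defs
open import Data.Nat using (ℕ; _≤_; _^_)
open import Data.Nat.Primality using (Prime)
open import Data.List.Relation.Unary.All using (All)

open import Data.Bool using (true; false; if_then_else_; _∧_)
open import Data.Bool.Properties using (∧-zeroʳ)
open import Data.Empty using (⊥-elim)
open import Data.Integer as ℤ using (ℤ; +_; -_; _+_; _*_; _-_)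
import Data.Integer.Properties as ℤ
open import Data.Integer.Divisibility.Signed
  using (_∣_; divides; ∣m∣n⇒∣m+n; ∣m⇒∣-m; ∣m⇒∣m*n; ∣n⇒∣m*n; ∣ᵤ⇒∣; ∣⇒∣ᵤ)
open import Data.Integer.Tactic.RingSolver using (solve-∀)
open import Data.List using ([]; _∷_; _++_; concat; concatMap; length; applyUpTo; upTo)
open import Data.List.Properties
  using (≡-dec; ∷-injectiveˡ; ∷-injectiveʳ; map-++; map-upTo; ++-assoc; ++-identityʳ; length-map)
open import Data.List.Relation.Unary.All using ([]; _∷_)
open import Data.List.Relation.Unary.All.Properties using (++⁺; concat⁺; map⁺; applyUpTo⁺₂)
open import Data.Nat as ℕ using (zero; suc; _<_; _∸_; z≤n; s≤s; NonZero)
import Data.Nat.Properties as ℕ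
open import Data.Nat.Combinatorics using (_C_; nCk+nC[k+1]≡[n+1]C[k+1]; k>n⇒nCk≡0; nCn≡1; nC1≡n)
open import Data.Nat.Divisibility as ℕ∣ using (_∣?_) renaming (_∣_ to _∣ℕ_)
open import Data.Nat.DivMod using (_/_; _%_; m%n<n; m≡m%n+[m/n]*n; m<n*o⇒m/o<n)
open import Data.Nat.Primality using (euclidsLemma; prime[2]; prime⇒nonZero; prime⇒irreducible)
import Data.Nat.Tactic.RingSolver as ℕ-Ring
open import Data.Product using (_×_; _,_)
open import Data.Sum using (_⊎_; inj₁; inj₂; [_,_]′; map₂)
open import Function using (_∘_; id)
open import Function.Bundles using (mk⇔)
open import Level using (0ℓ)
open import Relation.Binary.Bundles using (Setoid)
open import Relation.Binary.Structures using (IsEquivalence)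
open import Relation.Binary.PropositionalEquality
  using (_≡_; _≢_; refl; sym; trans; cong; cong₂; subst; subst₂; module ≡-Reasoning)
import Relation.Binary.Reasoning.Setoid
open import Relation.Nullary using (Dec; yes; no; ¬_; does)
open import Relation.Nullary.Decidable using (does-⇔)

binom : ℕ → ℕ → ℤ
binom n k = + (n C k)

binom-pascal : ∀ n k → binom (suc n) (suc k) ≡ binom n k + binom n (suc k)
binom-pascal n k = cong +_ (sym (nCk+nC[k+1]≡[n+1]C[k+1] n k))

binom-vanishes : ∀ {n k} → n < k → binom n k ≡ + 0
binom-vanishes n<k = cong +_ (k>n⇒nCk≡0 n<k)

[k+1]*[n+1]C[k+1]≡[n+1]*nCk : ∀ n k → suc k ℕ.* (suc n C suc k) ≡ suc n ℕ.* (n C k)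
[k+1]*[n+1]C[k+1]≡[n+1]*nCk zero    zero    = refl
[k+1]*[n+1]C[k+1]≡[n+1]*nCk zero    (suc k) = ℕ.*-zeroʳ (suc (suc k))
[k+1]*[n+1]C[k+1]≡[n+1]*nCk (suc n) zero    =
  trans (ℕ.+-identityʳ _) (trans (nC1≡n (suc (suc n))) (sym (ℕ.*-identityʳ _)))
[k+1]*[n+1]C[k+1]≡[n+1]*nCk (suc n) (suc k) = begin
  suc (suc k) ℕ.* (suc (suc n) C suc (suc k))
    ≡⟨ cong (suc (suc k) ℕ.*_) (sym (nCk+nC[k+1]≡[n+1]C[k+1] (suc n) (suc k))) ⟩
  suc (suc k) ℕ.* (x ℕ.+ y)
    ≡⟨ distribute k x y ⟩
  x ℕ.+ (suc k ℕ.* x ℕ.+ suc (suc k) ℕ.* y)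
    ≡⟨ cong₂ (λ a b → x ℕ.+ (a ℕ.+ b)) ([k+1]*[n+1]C[k+1]≡[n+1]*nCk n k) ([k+1]*[n+1]C[k+1]≡[n+1]*nCk n (suc k)) ⟩
  x ℕ.+ (suc n ℕ.* (n C k) ℕ.+ suc n ℕ.* (n C suc k))
    ≡⟨ cong (x ℕ.+_) (sym (ℕ.*-distribˡ-+ (suc n) (n C k) (n C suc k))) ⟩
  x ℕ.+ suc n ℕ.* (n C k ℕ.+ n C suc k)
    ≡⟨ cong (λ t → x ℕ.+ suc n ℕ.* t) (nCk+nC[k+1]≡[n+1]C[k+1] n k) ⟩
  suc (suc n) ℕ.* x
    ∎
  where
  open ≡-Reasoning
  x y : ℕ
  x = suc n C suc k
  y = suc n C suc (suc k)
  distribute : ∀ k x y → suc (suc k) ℕ.* (x ℕ.+ y) ≡ x ℕ.+ (suc k ℕ.* x ℕ.+ suc (suc k) ℕ.* y)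
  distribute = ℕ-Ring.solve-∀

m≡n*[m/n]+m%n : ∀ m n .{{_ : NonZero n}} → m ≡ n ℕ.* (m / n) ℕ.+ m % n
m≡n*[m/n]+m%n m n = trans (m≡m%n+[m/n]*n m n) (trans (ℕ.+-comm (m % n) _) (cong (ℕ._+ m % n) (ℕ.*-comm (m / n) n)))

-- Formal sums

coeff-head-≡ : ∀ {w u c P} → w ≡ u → coeff w ((c , u) ∷ P) ≡ c + coeff w P
coeff-head-≡ {w} {u} w≡u with ≡-dec ℕ._≟_ w u
... | yes _   = refl
... | no w≢u = ⊥-elim (w≢u w≡u)

coeff-head-≢ : ∀ {w u c P} → w ≢ u → coeff w ((c , u) ∷ P) ≡ coeff w P
coeff-head-≢ {w} {u} w≢u with ≡-dec ℕ._≟_ w u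
... | yes w≡u = ⊥-elim (w≢u w≡u)
... | no _    = refl

coeff-++ : ∀ w P Q → coeff w (P ++ Q) ≡ coeff w P + coeff w Q
coeff-++ w []            Q = sym (ℤ.+-identityˡ (coeff w Q))
coeff-++ w ((c , u) ∷ P) Q with ≡-dec ℕ._≟_ w u
... | yes _ = trans (cong (λ t → c + t) (coeff-++ w P Q)) (sym (ℤ.+-assoc c (coeff w P) (coeff w Q)))
... | no _  = coeff-++ w P Q

coeff-scale : ∀ w c P → coeff w (scale c P) ≡ c * coeff w P
coeff-scale w c []            = sym (ℤ.*-zeroʳ c)
coeff-scale w c ((d , u) ∷ P) with ≡-dec ℕ._≟_ w u
... | yes _ = trans (cong (λ t → c * d + t) (coeff-scale w c P)) (sym (ℤ.*-distribˡ-+ c d (coeff w P)))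
... | no _  = coeff-scale w c P

coeff-prefix-match : ∀ i w P → coeff (i ∷ w) (prefix i P) ≡ coeff w P
coeff-prefix-match i w []            = refl
coeff-prefix-match i w ((d , u) ∷ P) = by-cases (≡-dec ℕ._≟_ w u)
  where
  by-cases : Dec (w ≡ u) → coeff (i ∷ w) (prefix i ((d , u) ∷ P)) ≡ coeff w ((d , u) ∷ P)
  by-cases (yes w≡u) = trans (coeff-head-≡ {P = prefix i P} (cong (i ∷_) w≡u))
                             (trans (cong (λ t → d + t) (coeff-prefix-match i w P)) (sym (coeff-head-≡ w≡u)))
  by-cases (no w≢u)  = trans (coeff-head-≢ {P = prefix i P} (w≢u ∘ ∷-injectiveʳ))
                             (trans (coeff-prefix-match i w P) (sym (coeff-head-≢ w≢u)))

coeff-prefix-mismatch : ∀ i w P → (∀ w′ → w ≢ i ∷ w′) → coeff w (prefix i P) ≡ + 0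
coeff-prefix-mismatch i w []            _        = refl
coeff-prefix-mismatch i w ((d , u) ∷ P) mismatch =
  trans (coeff-head-≢ (mismatch u)) (coeff-prefix-mismatch i w P mismatch)

extend : (Word → Poly) → Poly → Poly
extend F = concatMap (λ (d , v) → scale d (F v))

weightedSum : (Word → ℤ) → Poly → ℤ
weightedSum c []            = + 0
weightedSum c ((d , v) ∷ P) = d * c v + weightedSum c P

coeff-extend : ∀ w F P → coeff w (extend F P) ≡ weightedSum (λ v → coeff w (F v)) P
coeff-extend w F []            = refl
coeff-extend w F ((d , v) ∷ P) =
  trans (coeff-++ w (scale d (F v)) (extend F P)) (cong₂ _+_ (coeff-scale w d (F v)) (coeff-extend w F P))

weightedSum-++ : ∀ c P Q → weightedSum c (P ++ Q) ≡ weightedSum c P + weightedSum c Q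
weightedSum-++ c []            Q = sym (ℤ.+-identityˡ (weightedSum c Q))
weightedSum-++ c ((d , v) ∷ P) Q = trans (cong (λ t → d * c v + t) (weightedSum-++ c P Q))
                                         (sym (ℤ.+-assoc (d * c v) (weightedSum c P) (weightedSum c Q)))

weightedSum-scale : ∀ c e P → weightedSum c (scale e P) ≡ e * weightedSum c P
weightedSum-scale c e []            = sym (ℤ.*-zeroʳ e)
weightedSum-scale c e ((d , v) ∷ P) = trans (cong (λ t → e * d * c v + t) (weightedSum-scale c e P))
                                            (distribute e d (c v) (weightedSum c P))
  where distribute : ∀ e d x y → e * d * x + e * y ≡ e * (d * x + y)
        distribute = solve-∀

erase : Word → Poly → Poly
erase v []            = []
erase v ((d , u) ∷ P) with ≡-dec ℕ._≟_ v u
... | yes _ = erase v P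
... | no _  = (d , u) ∷ erase v P

weightedSum-erase : ∀ c v P → weightedSum c P ≡ coeff v P * c v + weightedSum c (erase v P)
weightedSum-erase c v []            = refl
weightedSum-erase c v ((d , u) ∷ P) with ≡-dec ℕ._≟_ v u
... | yes refl = trans (cong (λ t → d * c v + t) (weightedSum-erase c v P))
                       (collect d (coeff v P) (c v) (weightedSum c (erase v P)))
  where collect : ∀ d e x y → d * x + (e * x + y) ≡ (d + e) * x + y
        collect = solve-∀
... | no _     = trans (cong (λ t → d * c u + t) (weightedSum-erase c v P))
                       (swap (d * c u) (coeff v P * c v) (weightedSum c (erase v P)))
  where swap : ∀ x y z → x + (y + z) ≡ y + (x + z)
        swap = solve-∀

coeff-erase-≡ : ∀ v P → coeff v (erase v P) ≡ + 0
coeff-erase-≡ v []            = refl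
coeff-erase-≡ v ((d , u) ∷ P) with ≡-dec ℕ._≟_ v u
... | yes _   = coeff-erase-≡ v P
... | no v≢u  = trans (coeff-head-≢ v≢u) (coeff-erase-≡ v P)

coeff-erase-≢ : ∀ {w v} P → w ≢ v → coeff w (erase v P) ≡ coeff w P
coeff-erase-≢ []            _   = refl
coeff-erase-≢ {w} {v} ((d , u) ∷ P) w≢v with ≡-dec ℕ._≟_ v u
... | yes refl = trans (coeff-erase-≢ P w≢v) (sym (coeff-head-≢ w≢v))
... | no _     with ≡-dec ℕ._≟_ w u
...   | yes _ = cong (λ t → d + t) (coeff-erase-≢ P w≢v)
...   | no _  = coeff-erase-≢ P w≢v

length-erase : ∀ v P → length (erase v P) ≤ length P
length-erase v []            = z≤n
length-erase v ((d , u) ∷ P) with ≡-dec ℕ._≟_ v u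
... | yes _ = ℕ.m≤n⇒m≤1+n (length-erase v P)
... | no _  = s≤s (length-erase v P)

length-erase-head : ∀ v d P → length (erase v ((d , v) ∷ P)) ≤ length P
length-erase-head v d P with ≡-dec ℕ._≟_ v v
... | yes _   = length-erase v P
... | no v≢v = ⊥-elim (v≢v refl)

starP-prefix : ∀ q a P → starP q (prefix a P) ≡ prefix (q ℕ.* a) (starP q P)
starP-prefix q a []            = refl
starP-prefix q a ((d , w) ∷ P) = cong ((d , q ℕ.* a ∷ starW q w) ∷_) (starP-prefix q a P)

starP-scale : ∀ q c P → starP q (scale c P) ≡ scale c (starP q P)
starP-scale q c []            = refl
starP-scale q c ((d , w) ∷ P) = cong ((c * d , starW q w) ∷_) (starP-scale q c P)

starP-extend : ∀ q F P → starP q (extend F P) ≡ extend (starP q ∘ F) P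
starP-extend q F []            = refl
starP-extend q F ((d , v) ∷ P) = trans (map-++ _ (scale d (F v)) (extend F P))
                                       (cong₂ _++_ (starP-scale q d (F v)) (starP-extend q F P))

extend-starP : ∀ q F P → extend F (starP q P) ≡ extend (F ∘ starW q) P
extend-starP q F []            = refl
extend-starP q F ((d , v) ∷ P) = cong (scale d (F (starW q v)) ++_) (extend-starP q F P)

shP-singleton : ∀ q f u P → shP q f ((+ 1 , u) ∷ []) P ≡ extend (sh q f u) P
shP-singleton q f u P = trans (++-identityʳ _) (unit-coefficients P)
  where
  unit-coefficients : ∀ P → concatMap (λ (d , v) → scale (+ 1 * d) (sh q f u v)) P ≡ extend (sh q f u) P
  unit-coefficients []            = refl
  unit-coefficients ((d , v) ∷ P) =
    cong₂ _++_ (cong (λ c → scale c (sh q f u v)) (ℤ.*-identityˡ d)) (unit-coefficients P)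

⨁ : ℕ → (ℕ → Poly) → Poly
⨁ n G = concat (applyUpTo G n)

concatMap-upTo : ∀ (G : ℕ → Poly) n → concatMap G (upTo n) ≡ ⨁ n G
concatMap-upTo G n = cong concat (map-upTo G n)

⨁-+ : ∀ m n G → ⨁ (m ℕ.+ n) G ≡ ⨁ m G ++ ⨁ n (G ∘ (m ℕ.+_))
⨁-+ zero    n G = refl
⨁-+ (suc m) n G = trans (cong (G 0 ++_) (⨁-+ m n (G ∘ suc))) (sym (++-assoc (G 0) (⨁ m (G ∘ suc)) _))

starP-⨁ : ∀ q n G → starP q (⨁ n G) ≡ ⨁ n (starP q ∘ G)
starP-⨁ q zero    G = refl
starP-⨁ q (suc n) G =
  trans (map-++ _ (G 0) (⨁ n (G ∘ suc))) (cong (starP q (G 0) ++_) (starP-⨁ q n (G ∘ suc)))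

Positive : Word → Set
Positive = All (1 ≤_)

-- The diamond product also produces words containing the letter 0, but only with coefficient Δ = 0.
PositivelySupported : Poly → Set
PositivelySupported = All (λ (d , w) → d ≡ + 0 ⊎ Positive w)

prefix⁺ : ∀ {i} P → 1 ≤ i → PositivelySupported P → PositivelySupported (prefix i P)
prefix⁺ []      _   []              = []
prefix⁺ (_ ∷ P) i⁺ (inj₁ d≡0 ∷ P⁺) = inj₁ d≡0 ∷ prefix⁺ P i⁺ P⁺
prefix⁺ (_ ∷ P) i⁺ (inj₂ w⁺ ∷ P⁺)  = inj₂ (i⁺ ∷ w⁺) ∷ prefix⁺ P i⁺ P⁺

scale⁺ : ∀ c P → PositivelySupported P → PositivelySupported (scale c P)
scale⁺ c []            []              = []
scale⁺ c ((d , _) ∷ P) (inj₁ d≡0 ∷ P⁺) = inj₁ (trans (cong (c *_) d≡0) (ℤ.*-zeroʳ c)) ∷ scale⁺ c P P⁺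
scale⁺ c (_ ∷ P)       (inj₂ w⁺ ∷ P⁺)  = inj₂ w⁺ ∷ scale⁺ c P P⁺

scale-zero⁺ : ∀ {c} P → c ≡ + 0 → PositivelySupported (scale c P)
scale-zero⁺ []            _    = []
scale-zero⁺ ((d , _) ∷ P) refl = inj₁ (ℤ.*-zeroˡ d) ∷ scale-zero⁺ P refl

extend⁺ : ∀ F P → (∀ {v} → Positive v → PositivelySupported (F v)) → PositivelySupported P →
          PositivelySupported (extend F P)
extend⁺ F []            _  []              = []
extend⁺ F ((_ , v) ∷ P) F⁺ (inj₁ d≡0 ∷ P⁺) = ++⁺ (scale-zero⁺ (F v) d≡0) (extend⁺ F P F⁺ P⁺)
extend⁺ F ((d , v) ∷ P) F⁺ (inj₂ v⁺ ∷ P⁺)  = ++⁺ (scale⁺ d (F v) (F⁺ v⁺)) (extend⁺ F P F⁺ P⁺)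

-- Congruence modulo p

module Modulo (p : ℕ) where

  -- A record rather than a synonym for + p ∣ x - y, so that x and y can be inferred.
  infix 4 _≋_
  record _≋_ (x y : ℤ) : Set where
    constructor mod-p
    field divides-difference : + p ∣ x - y
  open _≋_ public

  ≋-reflexive : ∀ {x y} → x ≡ y → x ≋ y
  ≋-reflexive {x} refl = mod-p (divides (+ 0) (trans (ℤ.+-inverseʳ x) (sym (ℤ.*-zeroˡ (+ p)))))

  ≋-refl : ∀ {x} → x ≋ x
  ≋-refl = ≋-reflexive refl

  ≋-sym : ∀ {x y} → x ≋ y → y ≋ x
  ≋-sym {x} {y} (mod-p p∣x-y) = mod-p (subst (+ p ∣_) (negate x y) (∣m⇒∣-m p∣x-y))
    where negate : ∀ x y → - (x - y) ≡ y - x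
          negate = solve-∀

  ≋-trans : ∀ {x y z} → x ≋ y → y ≋ z → x ≋ z
  ≋-trans {x} {y} {z} (mod-p p∣x-y) (mod-p p∣y-z) =
    mod-p (subst (+ p ∣_) (telescope x y z) (∣m∣n⇒∣m+n p∣x-y p∣y-z))
    where telescope : ∀ x y z → (x - y) + (y - z) ≡ x - z
          telescope = solve-∀

  ≋-isEquivalence : IsEquivalence _≋_
  ≋-isEquivalence = record { refl = ≋-refl ; sym = ≋-sym ; trans = ≋-trans }

  ≋-setoid : Setoid 0ℓ 0ℓ
  ≋-setoid = record { isEquivalence = ≋-isEquivalence }

  module ≋-Reasoning = Relation.Binary.Reasoning.Setoid ≋-setoid

  +-cong : ∀ {x y x′ y′} → x ≋ y → x′ ≋ y′ → x + x′ ≋ y + y′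
  +-cong {x} {y} {x′} {y′} (mod-p d) (mod-p d′) = mod-p (subst (+ p ∣_) (regroup x y x′ y′) (∣m∣n⇒∣m+n d d′))
    where regroup : ∀ x y x′ y′ → (x - y) + (x′ - y′) ≡ (x + x′) - (y + y′)
          regroup = solve-∀

  *-cong : ∀ {x y x′ y′} → x ≋ y → x′ ≋ y′ → x * x′ ≋ y * y′
  *-cong {x} {y} {x′} {y′} (mod-p d) (mod-p d′) =
    mod-p (subst (+ p ∣_) (regroup x y x′ y′) (∣m∣n⇒∣m+n (∣m⇒∣m*n x′ d) (∣n⇒∣m*n y d′)))
    where regroup : ∀ x y x′ y′ → (x - y) * x′ + y * (x′ - y′) ≡ x * x′ - y * y′
          regroup = solve-∀

  ∣⇒≋0 : ∀ {x} → + p ∣ x → x ≋ + 0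
  ∣⇒≋0 {x} d = mod-p (subst (+ p ∣_) (sym (ℤ.+-identityʳ x)) d)

  ≋-difference : ∀ {x y} → x + - (+ 1) * y ≋ + 0 → x ≋ y
  ≋-difference {x} {y} (mod-p d) = mod-p (subst (+ p ∣_) (difference x y) d)
    where difference : ∀ x y → (x + - (+ 1) * y) - + 0 ≡ x - y
          difference = solve-∀

  if-cong : ∀ {g g′ x x′} → g ≡ g′ → x ≋ x′ → (if g then x else + 0) ≋ (if g′ then x′ else + 0)
  if-cong {g′ = true}  refl x≋x′ = x≋x′
  if-cong {g′ = false} refl _    = ≋-refl

  if-null : ∀ g {x} → x ≋ + 0 → (if g then x else + 0) ≋ + 0
  if-null true  x≋0 = x≋0
  if-null false _   = ≋-refl

  LucasBase : ℕ → Set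
  LucasBase q = ∀ m k r s → r < q → s < q → binom (q ℕ.* m ℕ.+ r) (q ℕ.* k ℕ.+ s) ≋ binom m k * binom r s

  infix 4 _≈_
  record _≈_ (P Q : Poly) : Set where
    constructor coeffwise
    field coeff-≋ : ∀ w → coeff w P ≋ coeff w Q
  open _≈_ public

  ≈-reflexive : ∀ {P Q} → P ≡ Q → P ≈ Q
  ≈-reflexive refl = coeffwise λ _ → ≋-refl

  ≈-refl : ∀ {P} → P ≈ P
  ≈-refl = ≈-reflexive refl

  ≈-sym : ∀ {P Q} → P ≈ Q → Q ≈ P
  ≈-sym e = coeffwise λ w → ≋-sym (coeff-≋ e w)

  ≈-trans : ∀ {P Q R} → P ≈ Q → Q ≈ R → P ≈ R
  ≈-trans e f = coeffwise λ w → ≋-trans (coeff-≋ e w) (coeff-≋ f w)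

  ≈-isEquivalence : IsEquivalence _≈_
  ≈-isEquivalence = record { refl = ≈-refl ; sym = ≈-sym ; trans = ≈-trans }

  ≈-setoid : Setoid 0ℓ 0ℓ
  ≈-setoid = record { isEquivalence = ≈-isEquivalence }

  module ≈-Reasoning = Relation.Binary.Reasoning.Setoid ≈-setoid

  ++-cong : ∀ {P P′ Q Q′} → P ≈ P′ → Q ≈ Q′ → P ++ Q ≈ P′ ++ Q′
  ++-cong {P} {P′} {Q} {Q′} e f = coeffwise λ w →
    subst₂ _≋_ (sym (coeff-++ w P Q)) (sym (coeff-++ w P′ Q′)) (+-cong (coeff-≋ e w) (coeff-≋ f w))

  scale-cong : ∀ {c c′ P P′} → c ≋ c′ → P ≈ P′ → scale c P ≈ scale c′ P′
  scale-cong {c} {c′} {P} {P′} e f = coeffwise λ w →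
    subst₂ _≋_ (sym (coeff-scale w c P)) (sym (coeff-scale w c′ P′)) (*-cong e (coeff-≋ f w))

  scale-null : ∀ {c} P → c ≋ + 0 → scale c P ≈ []
  scale-null {c} P c≋0 = coeffwise λ w →
    subst₂ _≋_ (sym (coeff-scale w c P)) (ℤ.*-zeroˡ (coeff w P)) (*-cong c≋0 (≋-refl {coeff w P}))

  prefix-cong : ∀ i {P P′} → P ≈ P′ → prefix i P ≈ prefix i P′
  prefix-cong i {P} {P′} e = coeffwise at
    where
    mismatch : ∀ w → (∀ w′ → w ≢ i ∷ w′) → coeff w (prefix i P) ≋ coeff w (prefix i P′)
    mismatch w w≢ = ≋-reflexive (trans (coeff-prefix-mismatch i w P w≢) (sym (coeff-prefix-mismatch i w P′ w≢)))
    at : ∀ w → coeff w (prefix i P) ≋ coeff w (prefix i P′)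
    at []      = mismatch [] λ _ ()
    at (j ∷ w) with j ℕ.≟ i
    ... | yes refl = subst₂ _≋_ (sym (coeff-prefix-match i w P)) (sym (coeff-prefix-match i w P′)) (coeff-≋ e w)
    ... | no j≢i   = mismatch (j ∷ w) λ _ e → j≢i (∷-injectiveˡ e)

  erase-cong : ∀ v {P Q} → P ≈ Q → erase v P ≈ erase v Q
  erase-cong v {P} {Q} e = coeffwise at
    where
    at : ∀ w → coeff w (erase v P) ≋ coeff w (erase v Q)
    at w with ≡-dec ℕ._≟_ w v
    ... | yes refl = ≋-reflexive (trans (coeff-erase-≡ w P) (sym (coeff-erase-≡ w Q)))
    ... | no w≢v   = subst₂ _≋_ (sym (coeff-erase-≢ P w≢v)) (sym (coeff-erase-≢ Q w≢v)) (coeff-≋ e w)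

  weightedSum-null : ∀ c {P} → P ≈ [] → weightedSum c P ≋ + 0
  weightedSum-null c {P} = by-length (length P) ℕ.≤-refl
    where
    open ≋-Reasoning
    by-length : ∀ n {P} → length P ≤ n → P ≈ [] → weightedSum c P ≋ + 0
    by-length _       {[]}               _            _    = ≋-refl
    by-length (suc n) {P@((d , v) ∷ P′)} (s≤s |P′|≤n) null = begin
      weightedSum c P                               ≡⟨ weightedSum-erase c v P ⟩
      coeff v P * c v + weightedSum c (erase v P)   ≈⟨ +-cong (*-cong (coeff-≋ null v) (≋-refl {c v})) erased ⟩
      + 0 * c v + + 0                               ≡⟨ cong (_+ + 0) (ℤ.*-zeroˡ (c v)) ⟩
      + 0                                           ∎
      where erased : weightedSum c (erase v P) ≋ + 0
            erased = by-length n (ℕ.≤-trans (length-erase-head v d P′) |P′|≤n) (erase-cong v null)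

  weightedSum-cong : ∀ c {P Q} → P ≈ Q → weightedSum c P ≋ weightedSum c Q
  weightedSum-cong c {P} {Q} e = ≋-difference (begin
    weightedSum c P + - (+ 1) * weightedSum c Q
      ≡⟨ cong (λ t → weightedSum c P + t) (sym (weightedSum-scale c (- (+ 1)) Q)) ⟩
    weightedSum c P + weightedSum c (scale (- (+ 1)) Q)
      ≡⟨ sym (weightedSum-++ c P (scale (- (+ 1)) Q)) ⟩
    weightedSum c (P ++ scale (- (+ 1)) Q)
      ≈⟨ weightedSum-null c difference-null ⟩
    + 0
      ∎)
    where
    open ≋-Reasoning
    difference-null : P ++ scale (- (+ 1)) Q ≈ []
    difference-null = coeffwise λ w → begin
      coeff w (P ++ scale (- (+ 1)) Q)         ≡⟨ coeff-++ w P (scale (- (+ 1)) Q) ⟩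
      coeff w P + coeff w (scale (- (+ 1)) Q)  ≡⟨ cong (λ t → coeff w P + t) (coeff-scale w (- (+ 1)) Q) ⟩
      coeff w P + - (+ 1) * coeff w Q          ≈⟨ +-cong (coeff-≋ e w) (≋-refl { - (+ 1) * coeff w Q}) ⟩
      coeff w Q + - (+ 1) * coeff w Q          ≡⟨ cancel (coeff w Q) ⟩
      + 0                                      ∎
      where cancel : ∀ x → x + - (+ 1) * x ≡ + 0
            cancel = solve-∀

  extend-cong : ∀ F {P Q} → P ≈ Q → extend F P ≈ extend F Q
  extend-cong F {P} {Q} e = coeffwise λ w →
    subst₂ _≋_ (sym (coeff-extend w F P)) (sym (coeff-extend w F Q)) (weightedSum-cong (λ v → coeff w (F v)) e)

  extend-pointwise : ∀ {F G} P → (∀ {v} → Positive v → F v ≈ G v) → PositivelySupported P →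
                     extend F P ≈ extend G P
  extend-pointwise []            _   []               = ≈-refl
  extend-pointwise ((_ , v) ∷ P) F≈G (inj₁ refl ∷ P⁺) =
    ++-cong (≈-trans (scale-null _ ≋-refl) (≈-sym (scale-null _ ≋-refl))) (extend-pointwise P F≈G P⁺)
  extend-pointwise ((d , v) ∷ P) F≈G (inj₂ v⁺ ∷ P⁺)   =
    ++-cong (scale-cong (≋-refl {d}) (F≈G v⁺)) (extend-pointwise P F≈G P⁺)

  ⨁-cong : ∀ n {G H} → (∀ i → G i ≈ H i) → ⨁ n G ≈ ⨁ n H
  ⨁-cong zero    _   = ≈-refl
  ⨁-cong (suc n) G≈H = ++-cong (G≈H 0) (⨁-cong n (G≈H ∘ suc))

  ⨁-null : ∀ n {G} → (∀ i → i < n → G i ≈ []) → ⨁ n G ≈ []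
  ⨁-null zero    _    = ≈-refl
  ⨁-null (suc n) null = ++-cong (null 0 (s≤s z≤n)) (⨁-null n λ i i<n → null (suc i) (s≤s i<n))

  ⨁-sparse : ∀ q .{{_ : NonZero q}} {G} → (∀ i → ¬ q ∣ℕ i → G i ≈ []) →
             ∀ N → ⨁ (1 ℕ.+ N ℕ.* q) G ≈ ⨁ (1 ℕ.+ N) (λ j → G (j ℕ.* q))
  ⨁-sparse q          _        zero    = ≈-refl
  ⨁-sparse q@(suc q′) {G} null (suc N) = begin
    ⨁ (1 ℕ.+ suc N ℕ.* q) G
      ≡⟨ cong (λ n → ⨁ n G) (sym (ℕ.+-suc q (N ℕ.* q))) ⟩
    ⨁ (q ℕ.+ (1 ℕ.+ N ℕ.* q)) G
      ≡⟨ ⨁-+ q (1 ℕ.+ N ℕ.* q) G ⟩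
    (G 0 ++ ⨁ q′ (G ∘ suc)) ++ ⨁ (1 ℕ.+ N ℕ.* q) (G ∘ (q ℕ.+_))
      ≡⟨ ++-assoc (G 0) (⨁ q′ (G ∘ suc)) _ ⟩
    G 0 ++ (⨁ q′ (G ∘ suc) ++ ⨁ (1 ℕ.+ N ℕ.* q) (G ∘ (q ℕ.+_)))
      ≈⟨ ++-cong (≈-refl {G 0}) (++-cong (⨁-null q′ (λ i i<q′ → null (suc i) (small i<q′)))
                                        (⨁-sparse q (λ i → null (q ℕ.+ i) ∘ shifted) N)) ⟩
    G 0 ++ ⨁ (1 ℕ.+ N) (λ j → G (q ℕ.+ j ℕ.* q))
      ∎
    where
    open ≈-Reasoning
    small : ∀ {i} → i < q′ → ¬ q ∣ℕ suc i
    small i<q′ q∣i+1 = ℕ.<⇒≱ (s≤s i<q′) (ℕ∣.∣⇒≤ q∣i+1)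
    shifted : ∀ {i} → ¬ q ∣ℕ i → ¬ q ∣ℕ q ℕ.+ i
    shifted q∤i q∣q+i = q∤i (ℕ∣.∣m+n∣m⇒∣n q∣q+i ℕ∣.∣-refl)

-- Lucas' theorem

module Lucas (p′ : ℕ) (p-prime : Prime (suc p′)) where
  private
    p : ℕ
    p = suc p′
  open Modulo p
  open ≋-Reasoning

  p∣pC[k+1] : ∀ k → suc k < p → binom p (suc k) ≋ + 0
  p∣pC[k+1] k k+1<p = ∣⇒≋0 (∣ᵤ⇒∣ p∣binomial)
    where
    p∣product : p ∣ℕ suc k ℕ.* (p C suc k)
    p∣product = ℕ∣.divides (p′ C k) (trans ([k+1]*[n+1]C[k+1]≡[n+1]*nCk p′ k) (ℕ.*-comm p (p′ C k)))
    p∣binomial : p ∣ℕ p C suc k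
    p∣binomial with euclidsLemma (suc k) (p C suc k) p-prime p∣product
    ... | inj₁ p∣k+1      = ⊥-elim (ℕ.<⇒≱ k+1<p (ℕ∣.∣⇒≤ p∣k+1))
    ... | inj₂ p∣binomial = p∣binomial

  [p+n]Ck≋nCk : ∀ n k → k < p → binom (p ℕ.+ n) k ≋ binom n k
  [p+n]Ck≋nCk zero    zero    _   = ≋-refl
  [p+n]Ck≋nCk zero    (suc k) k<p = begin
    binom (p ℕ.+ 0) (suc k)  ≡⟨ cong (λ t → binom t (suc k)) (ℕ.+-identityʳ p) ⟩
    binom p (suc k)          ≈⟨ p∣pC[k+1] k k<p ⟩
    binom 0 (suc k)          ∎
  [p+n]Ck≋nCk (suc n) zero    _   = ≋-refl
  [p+n]Ck≋nCk (suc n) (suc k) k<p = begin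
    binom (p ℕ.+ suc n) (suc k)                  ≡⟨ cong (λ t → binom t (suc k)) (ℕ.+-suc p n) ⟩
    binom (suc (p ℕ.+ n)) (suc k)                ≡⟨ binom-pascal (p ℕ.+ n) k ⟩
    binom (p ℕ.+ n) k + binom (p ℕ.+ n) (suc k)  ≈⟨ +-cong ([p+n]Ck≋nCk n k (ℕ.<-trans (ℕ.n<1+n k) k<p))
                                                            ([p+n]Ck≋nCk n (suc k) k<p) ⟩
    binom n k + binom n (suc k)                  ≡⟨ sym (binom-pascal n k) ⟩
    binom (suc n) (suc k)                        ∎

  [p+n]C[k+p]≋nC[k+p]+nCk : ∀ n k → binom (p ℕ.+ n) (k ℕ.+ p) ≋ binom n (k ℕ.+ p) + binom n k
  [p+n]C[k+p]≋nC[k+p]+nCk zero    zero    =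
    ≋-reflexive (trans (cong (λ t → binom t p) (ℕ.+-identityʳ p)) (cong +_ (nCn≡1 p)))
  [p+n]C[k+p]≋nC[k+p]+nCk zero    (suc k) =
    ≋-reflexive (trans (cong (λ t → binom t (suc k ℕ.+ p)) (ℕ.+-identityʳ p))
                       (binom-vanishes {p} {suc k ℕ.+ p} (ℕ.m<n+m p (s≤s z≤n))))
  [p+n]C[k+p]≋nC[k+p]+nCk (suc n) zero    = begin
    binom (p ℕ.+ suc n) p                   ≡⟨ cong (λ t → binom t p) (ℕ.+-suc p n) ⟩
    binom (suc (p ℕ.+ n)) p                 ≡⟨ binom-pascal (p ℕ.+ n) p′ ⟩
    binom (p ℕ.+ n) p′ + binom (p ℕ.+ n) p  ≈⟨ +-cong ([p+n]Ck≋nCk n p′ (ℕ.n<1+n p′))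
                                                      ([p+n]C[k+p]≋nC[k+p]+nCk n zero) ⟩
    binom n p′ + (binom n p + + 1)          ≡⟨ sym (ℤ.+-assoc (binom n p′) (binom n p) (+ 1)) ⟩
    (binom n p′ + binom n p) + + 1          ≡⟨ cong (_+ + 1) (sym (binom-pascal n p′)) ⟩
    binom (suc n) p + + 1                   ∎
  [p+n]C[k+p]≋nC[k+p]+nCk (suc n) (suc k) = begin
    binom (p ℕ.+ suc n) (suc k ℕ.+ p)
      ≡⟨ cong (λ t → binom t (suc k ℕ.+ p)) (ℕ.+-suc p n) ⟩
    binom (suc (p ℕ.+ n)) (suc (k ℕ.+ p))
      ≡⟨ binom-pascal (p ℕ.+ n) (k ℕ.+ p) ⟩
    binom (p ℕ.+ n) (k ℕ.+ p) + binom (p ℕ.+ n) (suc k ℕ.+ p)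
      ≈⟨ +-cong ([p+n]C[k+p]≋nC[k+p]+nCk n k) ([p+n]C[k+p]≋nC[k+p]+nCk n (suc k)) ⟩
    (binom n (k ℕ.+ p) + binom n k) + (binom n (suc k ℕ.+ p) + binom n (suc k))
      ≡⟨ interchange (binom n (k ℕ.+ p)) (binom n k) (binom n (suc k ℕ.+ p)) (binom n (suc k)) ⟩
    (binom n (k ℕ.+ p) + binom n (suc k ℕ.+ p)) + (binom n k + binom n (suc k))
      ≡⟨ sym (cong₂ _+_ (binom-pascal n (k ℕ.+ p)) (binom-pascal n k)) ⟩
    binom (suc n) (suc k ℕ.+ p) + binom (suc n) (suc k)
      ∎
    where interchange : ∀ a b c d → (a + b) + (c + d) ≡ (a + c) + (b + d)
          interchange = solve-∀

  module _ {r s} (r<p : r < p) (s<p : s < p) where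

    private
      shift-m : ∀ m → p ℕ.* suc m ℕ.+ r ≡ p ℕ.+ (p ℕ.* m ℕ.+ r)
      shift-m m = trans (cong (ℕ._+ r) (ℕ.*-suc p m)) (ℕ.+-assoc p (p ℕ.* m) r)

      shift-k : ∀ k → p ℕ.* suc k ℕ.+ s ≡ (p ℕ.* k ℕ.+ s) ℕ.+ p
      shift-k k = trans (cong (ℕ._+ s) (ℕ.*-suc p k)) (rotate p (p ℕ.* k) s)
        where rotate : ∀ a b c → (a ℕ.+ b) ℕ.+ c ≡ (b ℕ.+ c) ℕ.+ a
              rotate = ℕ-Ring.solve-∀

    lucas-digit : ∀ m k → binom (p ℕ.* m ℕ.+ r) (p ℕ.* k ℕ.+ s) ≋ binom m k * binom r s
    lucas-digit zero    zero    =
      ≋-reflexive (trans (cong₂ (λ a b → binom (a ℕ.+ r) (b ℕ.+ s)) (ℕ.*-zeroʳ p) (ℕ.*-zeroʳ p))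
                         (sym (ℤ.*-identityˡ (binom r s))))
    lucas-digit zero    (suc k) =
      ≋-reflexive (trans (cong (λ a → binom (a ℕ.+ r) (p ℕ.* suc k ℕ.+ s)) (ℕ.*-zeroʳ p))
                  (trans (binom-vanishes (ℕ.<-≤-trans r<p (ℕ.≤-trans (ℕ.m≤m*n p (suc k)) (ℕ.m≤m+n (p ℕ.* suc k) s))))
                         (sym (ℤ.*-zeroˡ (binom r s)))))
    lucas-digit (suc m) zero    = begin
      binom (p ℕ.* suc m ℕ.+ r) (p ℕ.* 0 ℕ.+ s)  ≡⟨ cong₂ binom (shift-m m) (cong (ℕ._+ s) (ℕ.*-zeroʳ p)) ⟩
      binom (p ℕ.+ (p ℕ.* m ℕ.+ r)) s            ≈⟨ [p+n]Ck≋nCk (p ℕ.* m ℕ.+ r) s s<p ⟩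
      binom (p ℕ.* m ℕ.+ r) s                    ≡⟨ cong (λ t → binom (p ℕ.* m ℕ.+ r) (t ℕ.+ s)) (sym (ℕ.*-zeroʳ p)) ⟩
      binom (p ℕ.* m ℕ.+ r) (p ℕ.* 0 ℕ.+ s)      ≈⟨ lucas-digit m zero ⟩
      binom (suc m) 0 * binom r s                ∎
    lucas-digit (suc m) (suc k) = begin
      binom (p ℕ.* suc m ℕ.+ r) (p ℕ.* suc k ℕ.+ s)
        ≡⟨ cong₂ binom (shift-m m) (shift-k k) ⟩
      binom (p ℕ.+ (p ℕ.* m ℕ.+ r)) ((p ℕ.* k ℕ.+ s) ℕ.+ p)
        ≈⟨ [p+n]C[k+p]≋nC[k+p]+nCk (p ℕ.* m ℕ.+ r) (p ℕ.* k ℕ.+ s) ⟩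
      binom (p ℕ.* m ℕ.+ r) ((p ℕ.* k ℕ.+ s) ℕ.+ p) + binom (p ℕ.* m ℕ.+ r) (p ℕ.* k ℕ.+ s)
        ≡⟨ cong (λ t → binom (p ℕ.* m ℕ.+ r) t + binom (p ℕ.* m ℕ.+ r) (p ℕ.* k ℕ.+ s)) (sym (shift-k k)) ⟩
      binom (p ℕ.* m ℕ.+ r) (p ℕ.* suc k ℕ.+ s) + binom (p ℕ.* m ℕ.+ r) (p ℕ.* k ℕ.+ s)
        ≈⟨ +-cong (lucas-digit m (suc k)) (lucas-digit m k) ⟩
      binom m (suc k) * binom r s + binom m k * binom r s
        ≡⟨ collect (binom m (suc k)) (binom m k) (binom r s) ⟩
      (binom m k + binom m (suc k)) * binom r s
        ≡⟨ cong (_* binom r s) (sym (binom-pascal m k)) ⟩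
      binom (suc m) (suc k) * binom r s
        ∎
      where collect : ∀ a b c → a * c + b * c ≡ (b + a) * c
            collect = solve-∀

  lucas : ∀ n → LucasBase (p ^ n)
  lucas zero    m k zero    zero    _ _ =
    ≋-reflexive (trans (cong₂ binom (unit m) (unit k)) (sym (ℤ.*-identityʳ (binom m k))))
    where unit : ∀ m → 1 ℕ.* m ℕ.+ 0 ≡ m
          unit m = trans (ℕ.+-identityʳ (1 ℕ.* m)) (ℕ.*-identityˡ m)
  lucas zero    m k (suc r) s       (s≤s ()) _
  lucas zero    m k zero    (suc s) _ (s≤s ())
  lucas (suc n) m k r       s       r<q s<q = begin
    binom (q ℕ.* m ℕ.+ r) (q ℕ.* k ℕ.+ s)
      ≡⟨ cong₂ binom (split m r) (split k s) ⟩
    binom (p ℕ.* (p ^ n ℕ.* m ℕ.+ r / p) ℕ.+ r % p) (p ℕ.* (p ^ n ℕ.* k ℕ.+ s / p) ℕ.+ s % p)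
      ≈⟨ lucas-digit (m%n<n r p) (m%n<n s p) (p ^ n ℕ.* m ℕ.+ r / p) (p ^ n ℕ.* k ℕ.+ s / p) ⟩
    binom (p ^ n ℕ.* m ℕ.+ r / p) (p ^ n ℕ.* k ℕ.+ s / p) * binom (r % p) (s % p)
      ≈⟨ *-cong (lucas n m k (r / p) (s / p) (high-digits r<q) (high-digits s<q)) (≋-refl {binom (r % p) (s % p)}) ⟩
    binom m k * binom (r / p) (s / p) * binom (r % p) (s % p)
      ≡⟨ ℤ.*-assoc (binom m k) (binom (r / p) (s / p)) (binom (r % p) (s % p)) ⟩
    binom m k * (binom (r / p) (s / p) * binom (r % p) (s % p))
      ≈⟨ *-cong (≋-refl {binom m k}) (≋-sym (lucas-digit (m%n<n r p) (m%n<n s p) (r / p) (s / p))) ⟩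
    binom m k * binom (p ℕ.* (r / p) ℕ.+ r % p) (p ℕ.* (s / p) ℕ.+ s % p)
      ≡⟨ cong₂ (λ a b → binom m k * binom a b) (sym (m≡n*[m/n]+m%n r p)) (sym (m≡n*[m/n]+m%n s p)) ⟩
    binom m k * binom r s
      ∎
    where
    q : ℕ
    q = p ^ suc n
    high-digits : ∀ {r} → r < q → r / p < p ^ n
    high-digits {r} r<q = m<n*o⇒m/o<n (subst (r <_) (ℕ.*-comm p (p ^ n)) r<q)
    split : ∀ m r → q ℕ.* m ℕ.+ r ≡ p ℕ.* (p ^ n ℕ.* m ℕ.+ r / p) ℕ.+ r % p
    split m r = trans (cong (q ℕ.* m ℕ.+_) (m≡n*[m/n]+m%n r p)) (regroup p (p ^ n) m (r / p) (r % p))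
      where regroup : ∀ p Q m x y → p ℕ.* Q ℕ.* m ℕ.+ (p ℕ.* x ℕ.+ y) ≡ p ℕ.* (Q ℕ.* m ℕ.+ x) ℕ.+ y
            regroup = ℕ-Ring.solve-∀

lucas : ∀ {p} → Prime p → ∀ n → Modulo.LucasBase p (p ^ n)
lucas {zero}   p-prime = ⊥-elim (ℕ.≢-nonZero⁻¹ 0 {{prime⇒nonZero p-prime}} refl)
lucas {suc p′} p-prime = Lucas.lucas p′ p-prime

Δ-term : ℕ → ℕ → ℤ
Δ-term a i = sign (a ∸ 1) * binom (i ∸ 1) (a ∸ 1)

Δ-at-zero : ∀ q a b → Δ q a b 0 ≡ + 0
Δ-at-zero q a b = cong (λ g → if g then Δ-term a 0 + Δ-term b 0 else + 0) (∧-zeroʳ (does ((q ∸ 1) ∣? 0)))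

Δ-support : ∀ q a b j → Δ q a b j ≢ + 0 → 0 < j × j < a ℕ.+ b
Δ-support q a b j = from-guard (does ((q ∸ 1) ∣? j)) (0 ℕ.<? j) (j ℕ.<? a ℕ.+ b)
  where
  from-guard : ∀ g (0<j? : Dec (0 < j)) (j<a+b? : Dec (j < a ℕ.+ b)) →
               (if g ∧ does 0<j? ∧ does j<a+b? then Δ-term a j + Δ-term b j else + 0) ≢ + 0 →
               0 < j × j < a ℕ.+ b
  from-guard true  (yes 0<j) (yes j<a+b) _   = 0<j , j<a+b
  from-guard true  (yes _)   (no _)      Δ≢0 = ⊥-elim (Δ≢0 refl)
  from-guard true  (no _)    _           Δ≢0 = ⊥-elim (Δ≢0 refl)
  from-guard false _         _           Δ≢0 = ⊥-elim (Δ≢0 refl)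

module _ (q : ℕ) where
  mutual
    sh⁺ : ∀ f {u v} → Positive u → Positive v → PositivelySupported (sh q f u v)
    sh⁺ f       {[]}            _             v⁺            = inj₂ v⁺ ∷ []
    sh⁺ f       {_ ∷ _} {[]}    u⁺            _             = inj₂ u⁺ ∷ []
    sh⁺ zero    {_ ∷ _} {_ ∷ _} _             _             = []
    sh⁺ (suc f) {a ∷ u} {b ∷ v} u⁺@(a⁺ ∷ u′⁺) v⁺@(b⁺ ∷ v′⁺) =
      ++⁺ (prefix⁺ _ a⁺ (sh⁺ f u′⁺ v⁺)) (++⁺ (prefix⁺ _ b⁺ (sh⁺ f u⁺ v′⁺)) (dm⁺ f a⁺ u′⁺ v′⁺))

    dm⁺ : ∀ f {a u b v} → 1 ≤ a → Positive u → Positive v → PositivelySupported (dm q f a u b v)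
    dm⁺ f {a} {u} {b} {v} a⁺ u⁺ v⁺ =
      ++⁺ (prefix⁺ _ (ℕ.≤-trans a⁺ (ℕ.m≤m+n a b)) (sh⁺ f u⁺ v⁺))
          (concat⁺ (map⁺ (applyUpTo⁺₂ id (a ℕ.+ b ℕ.+ 1) summand⁺)))
      where
      summand : ℕ → Poly
      summand j = scale (Δ q a b j) (prefix (a ℕ.+ b ∸ j) (shP q f ((+ 1 , j ∷ []) ∷ []) (sh q f u v)))
      summand⁺ : ∀ j → PositivelySupported (summand j)
      summand⁺ j with Δ q a b j ℤ.≟ + 0
      ... | yes Δ≡0 = scale-zero⁺ (prefix (a ℕ.+ b ∸ j) (shP q f ((+ 1 , j ∷ []) ∷ []) (sh q f u v))) Δ≡0
      ... | no Δ≢0  with Δ-support q a b j Δ≢0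
      ...   | 0<j , j<a+b = scale⁺ (Δ q a b j) _ (prefix⁺ _ (ℕ.m<n⇒0<n∸m j<a+b)
                (subst PositivelySupported (sym (shP-singleton q f (j ∷ []) (sh q f u v)))
                       (extend⁺ _ _ (sh⁺ f (0<j ∷ [])) (sh⁺ f u⁺ v⁺))))

sign≋1-mod-2 : ∀ x → Modulo._≋_ 2 (sign x) (+ 1)
sign≋1-mod-2 x = by-parity (does (2 ∣? x))
  where
  by-parity : ∀ b → Modulo._≋_ 2 (if b then + 1 else - (+ 1)) (+ 1)
  by-parity true  = Modulo.≋-refl 2
  by-parity false = Modulo.mod-p (divides (- (+ 1)) refl)

sign-scaled : ∀ p q′ → p ≡ 2 ⊎ 2 ∣ℕ q′ → ∀ a → Modulo._≋_ p (sign (suc q′ ℕ.* suc a ∸ 1)) (sign a)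
sign-scaled _ q′ (inj₁ refl) a =
  Modulo.≋-trans 2 (sign≋1-mod-2 (suc q′ ℕ.* suc a ∸ 1)) (Modulo.≋-sym 2 (sign≋1-mod-2 a))
sign-scaled p q′ (inj₂ 2∣q′) a =
  Modulo.≋-reflexive p (cong (λ b → if b then + 1 else - (+ 1)) (does-⇔ (mk⇔ to from) (2 ∣? _) (2 ∣? a)))
  where
  to : 2 ∣ℕ a ℕ.+ q′ ℕ.* suc a → 2 ∣ℕ a
  to 2∣ = ℕ∣.∣m+n∣m⇒∣n (subst (2 ∣ℕ_) (ℕ.+-comm a _) 2∣) (ℕ∣.∣m⇒∣m*n (suc a) 2∣q′)
  from : 2 ∣ℕ a → 2 ∣ℕ a ℕ.+ q′ ℕ.* suc a
  from 2∣a = ℕ∣.∣m∣n⇒∣m+n 2∣a (ℕ∣.∣m⇒∣m*n (suc a) 2∣q′)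

-- ⋆ q commutes with ⧢ and ⋄

module StarMorphism (p q′ : ℕ) (lucas-base : Modulo.LucasBase p (suc q′)) (parity : p ≡ 2 ⊎ 2 ∣ℕ q′) where
  private
    q : ℕ
    q = suc q′
  open Modulo p

  q*[1+a]∸1≡q*a+q′ : ∀ a → q ℕ.* suc a ∸ 1 ≡ q ℕ.* a ℕ.+ q′
  q*[1+a]∸1≡q*a+q′ a = trans (cong (_∸ 1) (ℕ.*-suc q a)) (ℕ.+-comm q′ (q ℕ.* a))

  binom-scaled : ∀ j a → binom (q ℕ.* suc j ∸ 1) (q ℕ.* suc a ∸ 1) ≋ binom j a
  binom-scaled j a = begin
    binom (q ℕ.* suc j ∸ 1) (q ℕ.* suc a ∸ 1)   ≡⟨ cong₂ binom (q*[1+a]∸1≡q*a+q′ j) (q*[1+a]∸1≡q*a+q′ a) ⟩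
    binom (q ℕ.* j ℕ.+ q′) (q ℕ.* a ℕ.+ q′)     ≈⟨ lucas-base j a q′ q′ ℕ.≤-refl ℕ.≤-refl ⟩
    binom j a * binom q′ q′                     ≡⟨ cong (λ t → binom j a * + t) (nCn≡1 q′) ⟩
    binom j a * + 1                             ≡⟨ ℤ.*-identityʳ (binom j a) ⟩
    binom j a                                   ∎
    where open ≋-Reasoning

  binom-scaled-vanishes : ∀ i a → ¬ q ∣ℕ suc i → binom i (q ℕ.* suc a ∸ 1) ≋ + 0
  binom-scaled-vanishes i a q∤i+1 = begin
    binom i (q ℕ.* suc a ∸ 1)                         ≡⟨ cong₂ binom digits (q*[1+a]∸1≡q*a+q′ a) ⟩
    binom (q ℕ.* (i / q) ℕ.+ i % q) (q ℕ.* a ℕ.+ q′)  ≈⟨ lucas-base (i / q) a (i % q) q′ (m%n<n i q) ℕ.≤-refl ⟩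
    binom (i / q) a * binom (i % q) q′                ≡⟨ cong (binom (i / q) a *_) (binom-vanishes i%q<q′) ⟩
    binom (i / q) a * + 0                             ≡⟨ ℤ.*-zeroʳ (binom (i / q) a) ⟩
    + 0                                               ∎
    where
    open ≋-Reasoning
    digits : i ≡ q ℕ.* (i / q) ℕ.+ i % q
    digits = m≡n*[m/n]+m%n i q
    i%q≢q′ : i % q ≢ q′
    i%q≢q′ i%q≡q′ = q∤i+1 (ℕ∣.divides (suc (i / q))
      (trans (cong suc digits) (trans (cong (λ r → suc (q ℕ.* (i / q) ℕ.+ r)) i%q≡q′) (regroup q′ (i / q)))))
      where regroup : ∀ q′ m → suc (suc q′ ℕ.* m ℕ.+ q′) ≡ suc m ℕ.* suc q′
            regroup = ℕ-Ring.solve-∀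
    i%q<q′ : i % q < q′
    i%q<q′ = ℕ.≤∧≢⇒< (ℕ.≤-pred (m%n<n i q)) i%q≢q′

  Δ-term-scaled : ∀ a j → Δ-term (q ℕ.* suc a) (q ℕ.* suc j) ≋ Δ-term (suc a) (suc j)
  Δ-term-scaled a j = *-cong (sign-scaled p q′ parity a) (binom-scaled j a)

  Δ-scaled : ∀ a b j → Δ q (q ℕ.* suc a) (q ℕ.* suc b) (q ℕ.* j) ≋ Δ q (suc a) (suc b) j
  Δ-scaled a b zero    = ≋-reflexive (begin
    Δ q (q ℕ.* suc a) (q ℕ.* suc b) (q ℕ.* 0)  ≡⟨ cong (Δ q (q ℕ.* suc a) (q ℕ.* suc b)) (ℕ.*-zeroʳ q) ⟩
    Δ q (q ℕ.* suc a) (q ℕ.* suc b) 0          ≡⟨ Δ-at-zero q (q ℕ.* suc a) (q ℕ.* suc b) ⟩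
    + 0                                        ≡⟨ sym (Δ-at-zero q (suc a) (suc b)) ⟩
    Δ q (suc a) (suc b) 0                      ∎)
    where open ≡-Reasoning
  Δ-scaled a b (suc j) = if-cong guards (+-cong (Δ-term-scaled a j) (Δ-term-scaled b j))
    where
    J AB : ℕ
    J  = suc j
    AB = suc a ℕ.+ suc b
    q′∣qJ⇒q′∣J : q′ ∣ℕ q ℕ.* J → q′ ∣ℕ J
    q′∣qJ⇒q′∣J d = ℕ∣.∣m+n∣m⇒∣n (subst (q′ ∣ℕ_) (ℕ.+-comm J _) d) (ℕ∣.∣m⇒∣m*n J ℕ∣.∣-refl)
    qJ<qAB⇒J<AB : q ℕ.* J < q ℕ.* suc a ℕ.+ q ℕ.* suc b → J < AB
    qJ<qAB⇒J<AB lt = ℕ.*-cancelˡ-< q J AB (subst (q ℕ.* J <_) (sym (ℕ.*-distribˡ-+ q (suc a) (suc b))) lt)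
    J<AB⇒qJ<qAB : J < AB → q ℕ.* J < q ℕ.* suc a ℕ.+ q ℕ.* suc b
    J<AB⇒qJ<qAB lt = subst (q ℕ.* J <_) (ℕ.*-distribˡ-+ q (suc a) (suc b)) (ℕ.*-monoʳ-< q lt)
    guards : does (q′ ∣? (q ℕ.* J)) ∧ does (0 ℕ.<? q ℕ.* J) ∧ does (q ℕ.* J ℕ.<? q ℕ.* suc a ℕ.+ q ℕ.* suc b)
           ≡ does (q′ ∣? J) ∧ does (0 ℕ.<? J) ∧ does (J ℕ.<? AB)
    guards = cong₂ _∧_
      (does-⇔ (mk⇔ q′∣qJ⇒q′∣J (λ d → ℕ∣.∣m∣n⇒∣m+n d (ℕ∣.∣m⇒∣m*n J ℕ∣.∣-refl)))
              (q′ ∣? (q ℕ.* J)) (q′ ∣? J))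
      (cong₂ _∧_ (does-⇔ (mk⇔ (λ _ → s≤s z≤n) (λ _ → s≤s z≤n)) (0 ℕ.<? q ℕ.* J) (0 ℕ.<? J))
                 (does-⇔ (mk⇔ qJ<qAB⇒J<AB J<AB⇒qJ<qAB) (q ℕ.* J ℕ.<? q ℕ.* suc a ℕ.+ q ℕ.* suc b) (J ℕ.<? AB)))

  Δ-vanishes : ∀ a b i → ¬ q ∣ℕ i → Δ q (q ℕ.* suc a) (q ℕ.* suc b) i ≋ + 0
  Δ-vanishes a b zero    q∤0   = ⊥-elim (q∤0 (q ℕ∣.∣0))
  Δ-vanishes a b (suc i) q∤i+1 =
    if-null (does (q′ ∣? suc i) ∧ does (0 ℕ.<? suc i) ∧ does (suc i ℕ.<? q ℕ.* suc a ℕ.+ q ℕ.* suc b))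
            (+-cong (term a) (term b))
    where
    term : ∀ a → Δ-term (q ℕ.* suc a) (suc i) ≋ + 0
    term a = subst (Δ-term (q ℕ.* suc a) (suc i) ≋_) (ℤ.*-zeroʳ (sign (q ℕ.* suc a ∸ 1)))
                   (*-cong (≋-refl {sign (q ℕ.* suc a ∸ 1)}) (binom-scaled-vanishes i a q∤i+1))

  mutual
    starP-sh : ∀ f {u v} → Positive u → Positive v → starP q (sh q f u v) ≈ sh q f (starW q u) (starW q v)
    starP-sh f       {[]}             _ _ = ≈-refl
    starP-sh f       {_ ∷ _} {[]}     _ _ = ≈-refl
    starP-sh zero    {_ ∷ _} {_ ∷ _}  _ _ = ≈-refl
    starP-sh (suc f) {a ∷ u} {b ∷ v} u⁺@(a⁺ ∷ u′⁺) v⁺@(b⁺ ∷ v′⁺) = begin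
      starP q (prefix a X ++ prefix b Y ++ D)
        ≡⟨ trans (map-++ _ (prefix a X) _) (cong₂ _++_ (starP-prefix q a X)
                 (trans (map-++ _ (prefix b Y) D) (cong (_++ starP q D) (starP-prefix q b Y)))) ⟩
      prefix (q ℕ.* a) (starP q X) ++ prefix (q ℕ.* b) (starP q Y) ++ starP q D
        ≈⟨ ++-cong (prefix-cong _ (starP-sh f u′⁺ v⁺))
                   (++-cong (prefix-cong _ (starP-sh f u⁺ v′⁺)) (starP-dm f a⁺ b⁺ u′⁺ v′⁺)) ⟩
      sh q (suc f) (starW q (a ∷ u)) (starW q (b ∷ v))
        ∎
      where
      open ≈-Reasoning
      X Y D : Poly
      X = sh q f u (b ∷ v)
      Y = sh q f (a ∷ u) v
      D = dm q f a u b v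

    starP-shP-letter : ∀ f {j u v} → 1 ≤ j → Positive u → Positive v →
      starP q (shP q f ((+ 1 , j ∷ []) ∷ []) (sh q f u v))
        ≈ shP q f ((+ 1 , q ℕ.* j ∷ []) ∷ []) (sh q f (starW q u) (starW q v))
    starP-shP-letter f {j} {u} {v} j⁺ u⁺ v⁺ = begin
      starP q (shP q f ((+ 1 , j ∷ []) ∷ []) S)   ≡⟨ cong (starP q) (shP-singleton q f (j ∷ []) S) ⟩
      starP q (extend (sh q f (j ∷ [])) S)        ≡⟨ starP-extend q (sh q f (j ∷ [])) S ⟩
      extend (starP q ∘ sh q f (j ∷ [])) S        ≈⟨ extend-pointwise S (starP-sh f (j⁺ ∷ [])) (sh⁺ q f u⁺ v⁺) ⟩
      extend (sh q f (q ℕ.* j ∷ []) ∘ starW q) S  ≡⟨ sym (extend-starP q (sh q f (q ℕ.* j ∷ [])) S) ⟩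
      extend (sh q f (q ℕ.* j ∷ [])) (starP q S)  ≈⟨ extend-cong (sh q f (q ℕ.* j ∷ [])) (starP-sh f u⁺ v⁺) ⟩
      extend (sh q f (q ℕ.* j ∷ [])) S*           ≡⟨ sym (shP-singleton q f (q ℕ.* j ∷ []) S*) ⟩
      shP q f ((+ 1 , q ℕ.* j ∷ []) ∷ []) S*      ∎
      where
      open ≈-Reasoning
      S S* : Poly
      S  = sh q f u v
      S* = sh q f (starW q u) (starW q v)

    starP-dm : ∀ f {a b u v} → 1 ≤ a → 1 ≤ b → Positive u → Positive v →
      starP q (dm q f a u b v) ≈ dm q f (q ℕ.* a) (starW q u) (q ℕ.* b) (starW q v)
    starP-dm f {suc a} {suc b} {u} {v} _ _ u⁺ v⁺ = begin
      starP q (prefix A S ++ concatMap G (upTo (A ℕ.+ 1)))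
        ≡⟨ cong (λ T → starP q (prefix A S ++ T)) (concatMap-upTo G (A ℕ.+ 1)) ⟩
      starP q (prefix A S ++ ⨁ (A ℕ.+ 1) G)
        ≡⟨ trans (map-++ _ (prefix A S) _) (cong₂ _++_ (starP-prefix q A S) (starP-⨁ q (A ℕ.+ 1) G)) ⟩
      prefix (q ℕ.* A) (starP q S) ++ ⨁ (A ℕ.+ 1) (starP q ∘ G)
        ≈⟨ ++-cong (prefix-cong (q ℕ.* A) (starP-sh f u⁺ v⁺)) (⨁-cong (A ℕ.+ 1) summand) ⟩
      prefix (q ℕ.* A) S* ++ ⨁ (A ℕ.+ 1) (λ j → G* (j ℕ.* q))
        ≡⟨ cong₂ (λ n m → prefix n S* ++ ⨁ m (λ j → G* (j ℕ.* q)))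
                 (ℕ.*-distribˡ-+ q (suc a) (suc b)) (ℕ.+-comm A 1) ⟩
      prefix A* S* ++ ⨁ (1 ℕ.+ A) (λ j → G* (j ℕ.* q))
        ≈⟨ ++-cong (≈-refl {prefix A* S*}) (≈-sym (⨁-sparse q vanishing A)) ⟩
      prefix A* S* ++ ⨁ (1 ℕ.+ A ℕ.* q) G*
        ≡⟨ cong (λ n → prefix A* S* ++ ⨁ n G*) (bound (suc a) (suc b) q) ⟩
      prefix A* S* ++ ⨁ (A* ℕ.+ 1) G*
        ≡⟨ cong (prefix A* S* ++_) (sym (concatMap-upTo G* (A* ℕ.+ 1))) ⟩
      dm q f (q ℕ.* suc a) (starW q u) (q ℕ.* suc b) (starW q v)
        ∎
      where
      open ≈-Reasoning
      A A₁ A₂ A* : ℕ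
      A  = suc a ℕ.+ suc b
      A₁ = q ℕ.* suc a
      A₂ = q ℕ.* suc b
      A* = A₁ ℕ.+ A₂
      S S* : Poly
      S  = sh q f u v
      S* = sh q f (starW q u) (starW q v)
      letter⧢ : ℕ → Poly → Poly
      letter⧢ i = shP q f ((+ 1 , i ∷ []) ∷ [])
      Δ₁ Δq : ℕ → ℤ
      Δ₁ = Δ q (suc a) (suc b)
      Δq = Δ q A₁ A₂
      G : ℕ → Poly
      G j = scale (Δ₁ j) (prefix (A ∸ j) (letter⧢ j S))
      G* : ℕ → Poly
      G* i = scale (Δq i) (prefix (A* ∸ i) (letter⧢ i S*))
      bound : ∀ a b q → 1 ℕ.+ (a ℕ.+ b) ℕ.* q ≡ q ℕ.* a ℕ.+ q ℕ.* b ℕ.+ 1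
      bound = ℕ-Ring.solve-∀
      vanishing : ∀ i → ¬ q ∣ℕ i → G* i ≈ []
      vanishing i q∤i = scale-null _ (Δ-vanishes a b i q∤i)
      summand : ∀ j → starP q (G j) ≈ G* (j ℕ.* q)
      summand zero    = begin
        starP q (G 0)                                    ≡⟨ starP-scale q (Δ₁ 0) _ ⟩
        scale (Δ₁ 0) (starP q (prefix A (letter⧢ 0 S)))  ≈⟨ scale-null _ (≋-reflexive (Δ-at-zero q (suc a) (suc b))) ⟩
        []                                               ≈⟨ ≈-sym (scale-null _ (≋-reflexive (Δ-at-zero q A₁ A₂))) ⟩
        G* 0                                             ∎
      summand (suc j) = begin
        starP q (G J)
          ≡⟨ trans (starP-scale q (Δ₁ J) _) (cong (scale (Δ₁ J)) (starP-prefix q (A ∸ J) _)) ⟩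
        scale (Δ₁ J) (prefix (q ℕ.* (A ∸ J)) (starP q (letter⧢ J S)))
          ≈⟨ scale-cong (≋-sym (Δ-scaled a b J)) (prefix-cong _ (starP-shP-letter f (s≤s z≤n) u⁺ v⁺)) ⟩
        scale (Δq (q ℕ.* J)) (prefix (q ℕ.* (A ∸ J)) (letter⧢ (q ℕ.* J) S*))
          ≡⟨ cong (λ n → scale (Δq (q ℕ.* J)) (prefix n (letter⧢ (q ℕ.* J) S*))) prefix-index ⟩
        G* (q ℕ.* J)
          ≡⟨ cong G* (ℕ.*-comm q J) ⟩
        G* (J ℕ.* q)
          ∎
        where
        J : ℕ
        J = suc j
        prefix-index : q ℕ.* (A ∸ J) ≡ A* ∸ q ℕ.* J
        prefix-index = trans (ℕ.*-distribˡ-∸ q A J) (cong (ℕ._∸ q ℕ.* J) (ℕ.*-distribˡ-+ q (suc a) (suc b)))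

even⊎odd : ∀ n → 2 ∣ℕ n ⊎ 2 ∣ℕ suc n
even⊎odd zero    = inj₁ (2 ℕ∣.∣0)
even⊎odd (suc n) = [ (λ 2∣n → inj₂ (ℕ∣.∣m∣n⇒∣m+n (ℕ∣.∣-refl {2}) 2∣n)) , inj₁ ]′ (even⊎odd n)

starP-shuffle : ∀ p q .{{_ : NonZero q}} → Modulo.LucasBase p q → p ≡ 2 ⊎ ¬ 2 ∣ℕ q →
               ∀ {u v} → Positive u → Positive v →
               starP q (shuffle q u v) ≈[ p ] shuffle q (starW q u) (starW q v)
starP-shuffle p q@(suc q′) lucas-base p≡2⊎odd {u} {v} u⁺ v⁺ w = ∣⇒∣ᵤ (divides-difference (coeff-≋ commutes w))
  where
  open Modulo p
  parity : p ≡ 2 ⊎ 2 ∣ℕ q′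
  parity = map₂ (λ q-odd → [ id , ⊥-elim ∘ q-odd ]′ (even⊎odd q′)) p≡2⊎odd
  commutes : starP q (shuffle q u v) ≈ shuffle q (starW q u) (starW q v)
  commutes = subst (λ f → starP q (shuffle q u v) ≈ sh q f (starW q u) (starW q v))
                   (sym (cong₂ ℕ._+_ (length-map (q ℕ.*_) u) (length-map (q ℕ.*_) v)))
                   (StarMorphism.starP-sh p q′ lucas-base parity (length u ℕ.+ length v) u⁺ v⁺)

prime-power-parity : ∀ {p} → Prime p → ∀ n → p ≡ 2 ⊎ ¬ 2 ∣ℕ p ^ n
prime-power-parity {p} p-prime n with 2 ∣? p
... | yes 2∣p = inj₁ ([ (λ ()) , sym ]′ (prime⇒irreducible p-prime 2∣p))
... | no 2∤p  = inj₂ (odd-power n)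
  where
  odd-power : ∀ n → ¬ 2 ∣ℕ p ^ n
  odd-power zero    2∣1 with ℕ∣.∣⇒≤ 2∣1
  ... | s≤s ()
  odd-power (suc n) 2∣pⁿ⁺¹ = [ 2∤p , odd-power n ]′ (euclidsLemma p (p ^ n) prime[2] 2∣pⁿ⁺¹)

lemma8p11 : (p n : ℕ) → Prime p → 1 ≤ n →
    (u v : Word) → All (1 ≤_) u → All (1 ≤_) v →
    starP (p ^ n) (shuffle (p ^ n) u v)
      ≈[ p ] shuffle (p ^ n) (starW (p ^ n) u) (starW (p ^ n) v)
lemma8p11 p n p-prime _ u v u⁺ v⁺ =
  starP-shuffle p (p ^ n) {{ℕ.m^n≢0 p n}} (lucas p-prime n) (prime-power-parity p-prime n) u⁺ v⁺
  where instance _ = prime⇒nonZero p-prime
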